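{- Let $b$ be a constant, take $a=1$, and for inputs $X,W,Y,Z$ define $(\hat X,\hat W,\hat Y,\hat Z)$ as follows: $E=XZ$, $F=YW$, $G=XY$, $H=WZ$, $H'=bH$, $S=E+F$, $T=E-F$, $A_+=2G-S-2H'$, $A_-=T$, $B_+=S(G-H-H')-2HH'$, $B_-=T(G-H+H')$, $A_1=A_++A_-$, $A_2=A_+-A_-$, $B_1=B_++B_-$, $B_2=B_+-B_-$, $C_1=2XT$, $C_2=-2YT$, $D_1=ZA_2+C_2$, $D_2=WA_1+C_1$, $\hat X=A_1B_1$, $\hat Y=A_2B_2$, $\hat W=C_1D_1$, $\hat Z=C_2D_2$ (so that $\hat X/\hat W=R(X/W,Y/Z)$ and $\hat Y/\hat Z=R(Y/Z,X/W)$ with $R(x,y)=\frac{(xy-y-b)(x^2y-x-by-b)}{x(x-y)(y^2-x-b)}$, i.e. this is projective doubling on the Lyness curve). Then there is a straight-line program on four parallel processors that computes $(\hat X,\hat W,\hat Y,\hat Z)$ from $(X,W,Y,Z)$ in which general multiplications occur in only $4$ sequential rounds and multiplication by the constant $b$ occurs in only $1$ round (each processor performing at most one operation per round), all other rounds consisting solely of additions, subtractions and multiplications by $2$ or $-1$; that is, with effective cost $4\mathbf{M}+1\mathbf{C}$.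
   Context: $\mathbf{M}$ denotes a general field (or ring) multiplication and $\mathbf{C}$ a multiplication by a fixed constant; the effective cost of a parallel program counts, for each type of multiplication, the number of rounds in which at least one processor performs such a multiplication, with additions, subtractions, negations, doubling ($2X=X+X$) and copying regarded as negligible. -}

module Defs where

open import Level using (Level)
open import Data.Nat using (ℕ; zero; suc) renaming (_+_ to _+ℕ_)
open import Data.Fin using (Fin)
open import Data.Fin.Patterns using (0F; 1F; 2F; 3F)
open import Data.Bool using (Bool; true; false; _∨_; if_then_else_)
open import Data.Vec using (Vec; _∷_; []; _++_; lookup; tabulate)
open import Data.Product using (_×_; _,_)
open import Algebra.Bundles using (CommutativeRing)

-- One operation of one processor in one round; operands are addresses of
-- previously computed values (inputs or results of earlier rounds).
-- Communication / storage is free (shared memory).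
data Op (m : ℕ) : Set where
  add  : Fin m → Fin m → Op m
  sub  : Fin m → Fin m → Op m
  neg  : Fin m → Op m
  dbl  : Fin m → Op m
  copy : Fin m → Op m           -- x         (negligible; also "idle")
  mul  : Fin m → Fin m → Op m
  mulC : Fin m → Op m

Round : ℕ → Set
Round m = Fin 4 → Op m

-- A parallel straight-line program over a memory of m values; each round
-- appends the 4 results to the memory; at the end 4 addresses are
-- designated as the outputs (X̂, Ŵ, Ŷ, Ẑ).
data Prog (m : ℕ) : Set where
  halt  : (x̂ ŵ ŷ ẑ : Fin m) → Prog m
  round : Round m → Prog (4 +ℕ m) → Prog m

isMul : ∀ {m} → Op m → Bool
isMul (mul _ _) = true
isMul _         = false

isMulC : ∀ {m} → Op m → Bool
isMulC (mulC _) = true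
isMulC _        = false

anyProc : ∀ {m} → (Op m → Bool) → Round m → Bool
anyProc f r = f (r 0F) ∨ f (r 1F) ∨ f (r 2F) ∨ f (r 3F)

costM : ∀ {m} → Prog m → ℕ
costM (halt _ _ _ _) = 0
costM (round r p)    = (if anyProc isMul r then 1 else 0) +ℕ costM p

costC : ∀ {m} → Prog m → ℕ
costC (halt _ _ _ _) = 0
costC (round r p)    = (if anyProc isMulC r then 1 else 0) +ℕ costC p

module Semantics {c ℓ : Level} (R : CommutativeRing c ℓ) (b : CommutativeRing.Carrier R) where
  open CommutativeRing R

  _−_ : Carrier → Carrier → Carrier
  x − y = x + (- y)

  two : Carrier → Carrier
  two x = x + x

  exec : ∀ {m} → Vec Carrier m → Op m → Carrier
  exec mem (add i j) = lookup mem i + lookup mem j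
  exec mem (sub i j) = lookup mem i − lookup mem j
  exec mem (neg i)   = - lookup mem i
  exec mem (dbl i)   = two (lookup mem i)
  exec mem (copy i)  = lookup mem i
  exec mem (mul i j) = lookup mem i * lookup mem j
  exec mem (mulC i)  = b * lookup mem i

  run : ∀ {m} → Prog m → Vec Carrier m → Carrier × Carrier × Carrier × Carrier
  run (halt x w y z) mem = lookup mem x , lookup mem w , lookup mem y , lookup mem z
  run (round r p)    mem = run p (tabulate (λ i → exec mem (r i)) ++ mem)

  runOn : Prog 4 → Carrier → Carrier → Carrier → Carrier → Carrier × Carrier × Carrier × Carrier
  runOn p X W Y Z = run p (X ∷ W ∷ Y ∷ Z ∷ [])

  lynessDouble : Carrier → Carrier → Carrier → Carrier → Carrier × Carrier × Carrier × Carrier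
  lynessDouble X W Y Z = X̂ , Ŵ , Ŷ , Ẑ
    where
    E  = X * Z
    F  = Y * W
    G  = X * Y
    H  = W * Z
    H' = b * H
    S  = E + F
    T  = E − F
    A₊ = (two G − S) − two H'
    A₋ = T
    B₊ = (S * ((G − H) − H')) − two (H * H')
    B₋ = T * ((G − H) + H')
    A₁ = A₊ + A₋
    A₂ = A₊ − A₋
    B₁ = B₊ + B₋
    B₂ = B₊ − B₋
    C₁ = two X * T
    C₂ = - (two Y) * T
    D₁ = Z * A₂ + C₂
    D₂ = W * A₁ + C₁
    X̂  = A₁ * B₁
    Ŷ  = A₂ * B₂
    Ŵ  = C₁ * D₁
    Ẑ  = C₂ * D₂

  _≈₄_ : Carrier × Carrier × Carrier × Carrier → Carrier × Carrier × Carrier × Carrier → Set ℓ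
  (a₁ , a₂ , a₃ , a₄) ≈₄ (b₁ , b₂ , b₃ , b₄) = (a₁ ≈ b₁) × (a₂ ≈ b₂) × (a₃ ≈ b₃) × (a₄ ≈ b₄)

-- We exhibit an explicit four-processor straight-line program and check
-- its three claimed properties separately.
--   * Schedule: general multiplications occur only in rounds 1, 7, 8 and
--     12, and the multiplication by b only in round 2 (H' = bH); every
--     other round uses only additions, subtractions, doublings, negations
--     and copies.  Running the program thus yields
--     the very same expressions as 'lynessDouble', i.e. the two agree up to
--     propositional equality, in every commutative ring and for every b.
--   * Propositional equality of 4-tuples implies componentwise equality in
--     the ring's setoid, which is the form the theorem asks for.
module Submission where

open import Defs
open import Level using (Level)
open import Data.Nat using (_+_; _≤_)
open import Data.Nat.Properties using (≤-reflexive)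
open import Data.Fin using (#_)
open import Data.Fin.Patterns using (0F; 1F; 2F; 3F)
open import Data.Product using (Σ; _×_; _,_)
open import Algebra.Bundles using (CommutativeRing)
open import Relation.Binary.PropositionalEquality using (_≡_; refl)

⟨_∣_∣_∣_⟩ : ∀ {m} → Op m → Op m → Op m → Op m → Round m
⟨ p₁ ∣ p₂ ∣ p₃ ∣ p₄ ⟩ 0F = p₁
⟨ p₁ ∣ p₂ ∣ p₃ ∣ p₄ ⟩ 1F = p₂
⟨ p₁ ∣ p₂ ∣ p₃ ∣ p₄ ⟩ 2F = p₃
⟨ p₁ ∣ p₂ ∣ p₃ ∣ p₄ ⟩ 3F = p₄

idle : ∀ {m} → Op (4 + m)
idle = copy (# 0)

-- Addresses are relative: after each round its four
-- results occupy addresses 0-3 and all older values shift up by 4.  The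
-- comment on each round lists the values it produces ('_' for idle).
lynessProgram : Prog 4
lynessProgram =
  -- E, F, G, H  =  XZ, YW, XY, WZ                                     (M)
  round ⟨ mul (# 0) (# 3) ∣ mul (# 2) (# 1) ∣ mul (# 0) (# 2) ∣ mul (# 1) (# 3) ⟩ (
  -- H', S, T, G−H  =  bH, E+F, E−F, G−H                               (C)
  round ⟨ mulC (# 3) ∣ add (# 0) (# 1) ∣ sub (# 0) (# 1) ∣ sub (# 2) (# 3) ⟩ (
  -- 2G, 2H', (G−H)−H', (G−H)+H'
  round ⟨ dbl (# 6) ∣ dbl (# 0) ∣ sub (# 3) (# 0) ∣ add (# 3) (# 0) ⟩ (
  -- 2G−S, 2X, 2Y, _
  round ⟨ sub (# 0) (# 5) ∣ dbl (# 12) ∣ dbl (# 14) ∣ idle ⟩ (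
  -- A₊ = (2G−S)−2H', −2Y, _, _
  round ⟨ sub (# 0) (# 5) ∣ neg (# 2) ∣ idle ∣ idle ⟩ (
  -- A₁ = A₊+T, A₂ = A₊−T, _, _
  round ⟨ add (# 0) (# 14) ∣ sub (# 0) (# 14) ∣ idle ∣ idle ⟩ (
  -- S((G−H)−H'), HH', B₋ = T((G−H)+H'), C₁ = 2X·T                     (M)
  round ⟨ mul (# 17) (# 14) ∣ mul (# 23) (# 16) ∣ mul (# 18) (# 15) ∣ mul (# 9) (# 18) ⟩ (
  -- C₂ = −2Y·T, ZA₂, WA₁, _                                           (M)
  round ⟨ mul (# 9) (# 22) ∣ mul (# 31) (# 5) ∣ mul (# 29) (# 4) ∣ idle ⟩ (
  -- 2HH', D₁ = ZA₂+C₂, D₂ = WA₁+C₁, _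
  round ⟨ dbl (# 5) ∣ add (# 1) (# 0) ∣ add (# 2) (# 7) ∣ idle ⟩ (
  -- B₊ = S((G−H)−H') − 2HH', _, _, _
  round ⟨ sub (# 8) (# 0) ∣ idle ∣ idle ∣ idle ⟩ (
  -- B₁ = B₊+B₋, B₂ = B₊−B₋, _, _
  round ⟨ add (# 0) (# 14) ∣ sub (# 0) (# 14) ∣ idle ∣ idle ⟩ (
  -- X̂ = A₁B₁, Ŷ = A₂B₂, Ŵ = C₁D₁, Ẑ = C₂D₂                           (M)
  round ⟨ mul (# 20) (# 0) ∣ mul (# 21) (# 1) ∣ mul (# 19) (# 9) ∣ mul (# 12) (# 10) ⟩ (
  halt (# 0) (# 2) (# 1) (# 3)))))))))))))

lynessProgram-costM : costM lynessProgram ≡ 4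
lynessProgram-costM = refl

lynessProgram-costC : costC lynessProgram ≡ 1
lynessProgram-costC = refl

module _ {c ℓ : Level} (R : CommutativeRing c ℓ) (b : CommutativeRing.Carrier R) where
  open CommutativeRing R using (Carrier) renaming (refl to ≈-refl)
  open Semantics R b using (runOn; lynessDouble; _≈₄_)

  -- The program evaluates to literally the paper's doubling formulas: each
  -- round builds the same subterms, so the outputs agree definitionally.
  lynessProgram-computes : (X W Y Z : Carrier) →
    runOn lynessProgram X W Y Z ≡ lynessDouble X W Y Z
  lynessProgram-computes X W Y Z = refl

  ≡⇒≈₄ : {p q : Carrier × Carrier × Carrier × Carrier} → p ≡ q → p ≈₄ q
  ≡⇒≈₄ refl = ≈-refl , ≈-refl , ≈-refl , ≈-refl

mainTheorem6 : (c ℓ : Level) →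
    Σ (Prog 4) λ P →
    (costM P ≤ 4) × (costC P ≤ 1) ×
    ((R : CommutativeRing c ℓ) (b X W Y Z : CommutativeRing.Carrier R) →
    Semantics._≈₄_ R b (Semantics.runOn R b P X W Y Z) (Semantics.lynessDouble R b X W Y Z))
mainTheorem6 c ℓ =
  lynessProgram ,
  ≤-reflexive lynessProgram-costM ,
  ≤-reflexive lynessProgram-costC ,
  λ R b X W Y Z → ≡⇒≈₄ R b (lynessProgram-computes R b X W Y Z)
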